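{- For each integer $n\ge 3$, $\mathcal{M}(2,n)=\left\lceil \tfrac{3}{2}n\right\rceil-3$.
   Context: For $n\ge2$ and $1\le k\le n-1$, let $s_k=(k\ k{+}1)\in S_n$ be the adjacent transposition and $w_0=n\,(n-1)\cdots 2\,1$ the longest permutation of $S_n$. $\mathcal{M}(k,n)$ denotes the maximum number of occurrences of $s_k$ in a reduced word (expression of minimal length as a product of adjacent transpositions) of $w_0$. -}

module Defs where

open import Data.Nat using (ℕ; zero; suc; _≤_; _∸_; _≟_)
open import Data.List using (List; []; _∷_; map; upTo; reverse; foldl; length; filter)
open import Data.List.Relation.Unary.All using (All)
open import Data.Product using (_×_; Σ)
open import Relation.Binary.PropositionalEquality using (_≡_)

-- Permutations of {1,…,n} in one-line notation [w(1), …, w(n)].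
-- A word is a list of generator indices i, standing for s_i = (i i+1).

-- swapAt k p : swap the entries in positions k and k+1 (1-indexed);
-- this is right multiplication p · s_k in one-line notation.
swapAt : ℕ → List ℕ → List ℕ
swapAt (suc zero) (a ∷ b ∷ xs) = b ∷ a ∷ xs
swapAt (suc (suc k)) (x ∷ xs) = x ∷ swapAt (suc k) xs
swapAt _ xs = xs

idPerm : ℕ → List ℕ
idPerm n = map suc (upTo n)

w₀ : ℕ → List ℕ
w₀ n = reverse (idPerm n)

ValidWord : ℕ → List ℕ → Set
ValidWord n w = All (λ i → (1 ≤ i) × (i ≤ n ∸ 1)) w

eval : ℕ → List ℕ → List ℕ
eval n w = foldl (λ p i → swapAt i p) (idPerm n) w

Reduced : ℕ → List ℕ → Set
Reduced n w = ValidWord n w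
  × (∀ v → ValidWord n v → eval n v ≡ eval n w → length w ≤ length v)

ReducedWordOfW₀ : ℕ → List ℕ → Set
ReducedWordOfW₀ n w = Reduced n w × eval n w ≡ w₀ n

occ : ℕ → List ℕ → ℕ
occ k w = length (filter (k ≟_) w)

IsM : ℕ → ℕ → ℕ → Set
IsM k n m = Σ (List ℕ) (λ w → ReducedWordOfW₀ n w × occ k w ≡ m)
  × (∀ w → ReducedWordOfW₀ n w → occ k w ≤ m)

-- Lower bound: the word  c(2) = s₁,  c(k+3) = c(k+1) · (s_{k+1} ⋯ s₂) · (s_{k+2} ⋯ s₁) · s₂
-- reverses 1 ⋯ k+3: after c(k+1) has reversed the first k+1 entries, the two
-- blocks bring k+2 to position 2 and k+3 to the front, and s₂ swaps k+1 and k+2.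
-- Its length is the number of inversions of w₀, so it is reduced, and it gains
-- three copies of s₂ every two steps.
--
-- Upper bound: a letter changes the number of inversions by at most one, so along
-- a reduced word of w₀ every letter acts on an ascent. Write a permutation as
-- a b c r, let m be the number of entries of r above the median of a, b, c, and
-- set Φ = ⌊3m/2⌋ + 2, 1, 1, 0 on the patterns 123, 132, 312, 321 of a b c and
-- Φ = ⌈3m/2⌉ + 1, 0 on the patterns 213, 231. An ascent at position 2 lowers Φ
-- by at least one and no other ascent raises it, so a reduced word of w₀ has at
-- most Φ(id) = 2 + ⌊3(n-3)/2⌋ = ⌈3n/2⌉ - 3 letters s₂.
module Submission where

open import Defs
open import Data.Bool using (Bool; true; false; T; if_then_else_)
open import Data.Nat using (ℕ; zero; suc; _+_; _*_; _∸_; _≤_; _<_; _≤′_; ≤′-refl; ≤′-step; _<ᵇ_; _≟_; s≤s; z≤n; ⌈_/2⌉)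
open import Data.Nat.Properties
open import Data.Nat.Tactic.RingSolver using (solve-∀)
open import Algebra.Properties.CommutativeSemigroup +-commutativeSemigroup using (x∙yz≈y∙xz)
open import Data.List using (List; []; _∷_; _++_; [_]; applyUpTo; applyDownFrom; reverse; foldl; length; filter)
open import Data.List.Properties using (foldl-++; length-++; ++-assoc; ++-identityʳ; filter-++; map-applyUpTo; reverse-applyUpTo; length-applyDownFrom)
open import Data.List.Relation.Unary.All using ([]; _∷_)
open import Data.List.Relation.Unary.All.Properties using (++⁺)
open import Data.Product using (_×_; _,_)
open import Data.Sum using (_⊎_; inj₁; inj₂)
open import Data.Empty using (⊥; ⊥-elim)
open import Data.Unit using (tt)
open import Relation.Binary.PropositionalEquality hiding ([_])
open import Function using (id)

applyWord : List ℕ → List ℕ → List ℕ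
applyWord = foldl (λ p i → swapAt i p)

applyWord-++ : ∀ p u v → applyWord p (u ++ v) ≡ applyWord (applyWord p u) v
applyWord-++ = foldl-++ (λ p i → swapAt i p)

swapAt-++ : ∀ (p : List ℕ) a b t → swapAt (suc (length p)) (p ++ a ∷ b ∷ t) ≡ p ++ b ∷ a ∷ t
swapAt-++ [] a b t = refl
swapAt-++ (x ∷ []) a b t = refl
swapAt-++ (x ∷ y ∷ p) a b t = cong (x ∷_) (swapAt-++ (y ∷ p) a b t)

ascending : ℕ → ℕ → List ℕ
ascending a zero = []
ascending a (suc n) = a ∷ ascending (suc a) n

applyUpTo≡ascending : ∀ {f : ℕ → ℕ} a n → (∀ i → f i ≡ a + i) → applyUpTo f n ≡ ascending a n
applyUpTo≡ascending a zero f≗ = refl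
applyUpTo≡ascending a (suc n) f≗ =
  cong₂ _∷_ (trans (f≗ 0) (+-identityʳ a))
            (applyUpTo≡ascending (suc a) n (λ i → trans (f≗ (suc i)) (+-suc a i)))

idPerm≡ascending : ∀ n → idPerm n ≡ ascending 1 n
idPerm≡ascending n = trans (map-applyUpTo id suc n) (applyUpTo≡ascending 1 n (λ _ → refl))

ascending-++² : ∀ a n → ascending a (2 + n) ≡ ascending a n ++ a + n ∷ suc (a + n) ∷ []
ascending-++² a zero rewrite +-identityʳ a = refl
ascending-++² a (suc n) rewrite ascending-++² (suc a) n | +-suc a n = refl

w₀≡applyDownFrom : ∀ n → w₀ n ≡ applyDownFrom suc n
w₀≡applyDownFrom n = trans (cong reverse (map-applyUpTo id suc n)) (reverse-applyUpTo suc n)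

-- A reduced word of w₀ with many s₂

bubbleLeft : ℕ → ℕ → List ℕ
bubbleLeft s zero = []
bubbleLeft s (suc len) = bubbleLeft (suc s) len ++ [ suc s ]

length-bubbleLeft : ∀ s len → length (bubbleLeft s len) ≡ len
length-bubbleLeft s zero = refl
length-bubbleLeft s (suc len) =
  trans (length-++ (bubbleLeft (suc s) len)) (trans (cong (_+ 1) (length-bubbleLeft (suc s) len)) (+-comm len 1))

applyWord-bubbleLeft : ∀ xs len (p : List ℕ) s y t → length xs ≡ len → length p ≡ s →
                       applyWord (p ++ xs ++ y ∷ t) (bubbleLeft s len) ≡ p ++ y ∷ xs ++ t
applyWord-bubbleLeft [] zero p s y t refl refl = refl
applyWord-bubbleLeft (x ∷ xs) (suc len) p s y t ∣xs∣≡len refl = begin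
    applyWord (p ++ x ∷ xs ++ y ∷ t) (bubbleLeft (suc s) len ++ [ suc s ])
  ≡⟨ applyWord-++ _ (bubbleLeft (suc s) len) [ suc s ] ⟩
    swapAt (suc s) (applyWord (p ++ x ∷ xs ++ y ∷ t) (bubbleLeft (suc s) len))
  ≡⟨ cong (λ z → swapAt (suc s) (applyWord z (bubbleLeft (suc s) len))) (sym (++-assoc p [ x ] (xs ++ y ∷ t))) ⟩
    swapAt (suc s) (applyWord ((p ++ [ x ]) ++ xs ++ y ∷ t) (bubbleLeft (suc s) len))
  ≡⟨ cong (swapAt (suc s)) (applyWord-bubbleLeft xs len (p ++ [ x ]) (suc s) y t (suc-injective ∣xs∣≡len) ∣p∷ʳx∣≡1+s) ⟩
    swapAt (suc s) ((p ++ [ x ]) ++ y ∷ xs ++ t)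
  ≡⟨ cong (swapAt (suc s)) (++-assoc p [ x ] (y ∷ xs ++ t)) ⟩
    swapAt (suc (length p)) (p ++ x ∷ y ∷ xs ++ t)
  ≡⟨ swapAt-++ p x y (xs ++ t) ⟩
    p ++ y ∷ x ∷ xs ++ t
  ∎
  where
    open ≡-Reasoning
    ∣p∷ʳx∣≡1+s : length (p ++ [ x ]) ≡ suc (length p)
    ∣p∷ʳx∣≡1+s = trans (length-++ p) (+-comm (length p) 1)

maxWord : ℕ → List ℕ
maxWord 0 = []
maxWord 1 = []
maxWord 2 = [ 1 ]
maxWord (suc (suc (suc k))) = maxWord (suc k) ++ bubbleLeft 1 k ++ bubbleLeft 0 (2 + k) ++ [ 2 ]

applyWord-maxWord : ∀ m t → applyWord (ascending 1 m ++ t) (maxWord m) ≡ applyDownFrom suc m ++ t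
applyWord-maxWord 0 t = refl
applyWord-maxWord 1 t = refl
applyWord-maxWord 2 t = refl
applyWord-maxWord (suc (suc (suc k))) t = begin
    applyWord (ascending 1 (3 + k) ++ t) (maxWord (suc k) ++ tail)
  ≡⟨ cong (λ z → applyWord (z ++ t) (maxWord (suc k) ++ tail)) (ascending-++² 1 (suc k)) ⟩
    applyWord ((ascending 1 (suc k) ++ 2 + k ∷ 3 + k ∷ []) ++ t) (maxWord (suc k) ++ tail)
  ≡⟨ cong (λ z → applyWord z (maxWord (suc k) ++ tail)) (++-assoc (ascending 1 (suc k)) _ t) ⟩
    applyWord (ascending 1 (suc k) ++ 2 + k ∷ 3 + k ∷ t) (maxWord (suc k) ++ tail)
  ≡⟨ applyWord-++ _ (maxWord (suc k)) tail ⟩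
    applyWord (applyWord (ascending 1 (suc k) ++ 2 + k ∷ 3 + k ∷ t) (maxWord (suc k))) tail
  ≡⟨ cong (λ z → applyWord z tail) (applyWord-maxWord (suc k) (2 + k ∷ 3 + k ∷ t)) ⟩
    applyWord ([ suc k ] ++ applyDownFrom suc k ++ 2 + k ∷ 3 + k ∷ t) (bubbleLeft 1 k ++ bubbleLeft 0 (2 + k) ++ [ 2 ])
  ≡⟨ applyWord-++ _ (bubbleLeft 1 k) _ ⟩
    applyWord (applyWord ([ suc k ] ++ applyDownFrom suc k ++ 2 + k ∷ 3 + k ∷ t) (bubbleLeft 1 k)) (bubbleLeft 0 (2 + k) ++ [ 2 ])
  ≡⟨ cong (λ z → applyWord z (bubbleLeft 0 (2 + k) ++ [ 2 ]))
          (applyWord-bubbleLeft (applyDownFrom suc k) k [ suc k ] 1 (2 + k) (3 + k ∷ t) (length-applyDownFrom suc k) refl) ⟩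
    applyWord ([] ++ (suc k ∷ 2 + k ∷ applyDownFrom suc k) ++ 3 + k ∷ t) (bubbleLeft 0 (2 + k) ++ [ 2 ])
  ≡⟨ applyWord-++ _ (bubbleLeft 0 (2 + k)) [ 2 ] ⟩
    swapAt 2 (applyWord ([] ++ (suc k ∷ 2 + k ∷ applyDownFrom suc k) ++ 3 + k ∷ t) (bubbleLeft 0 (2 + k)))
  ≡⟨ cong (swapAt 2) (applyWord-bubbleLeft (suc k ∷ 2 + k ∷ applyDownFrom suc k) (2 + k) [] 0 (3 + k) t
                        (cong (2 +_) (length-applyDownFrom suc k)) refl) ⟩
    applyDownFrom suc (3 + k) ++ t
  ∎
  where
    open ≡-Reasoning
    tail = bubbleLeft 1 k ++ bubbleLeft 0 (2 + k) ++ [ 2 ]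

eval-maxWord : ∀ n → eval n (maxWord n) ≡ w₀ n
eval-maxWord n = begin
    applyWord (idPerm n) (maxWord n)
  ≡⟨ cong (λ z → applyWord z (maxWord n)) (trans (idPerm≡ascending n) (sym (++-identityʳ (ascending 1 n)))) ⟩
    applyWord (ascending 1 n ++ []) (maxWord n)
  ≡⟨ applyWord-maxWord n [] ⟩
    applyDownFrom suc n ++ []
  ≡⟨ ++-identityʳ (applyDownFrom suc n) ⟩
    applyDownFrom suc n
  ≡⟨ sym (w₀≡applyDownFrom n) ⟩
    w₀ n
  ∎
  where open ≡-Reasoning

bubbleLeft-valid : ∀ s len N → s + len ≤ N → ValidWord (suc N) (bubbleLeft s len)
bubbleLeft-valid s zero N s+len≤N = []
bubbleLeft-valid s (suc len) N s+1+len≤N =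
  ++⁺ (bubbleLeft-valid (suc s) len N (≤-trans (≤-reflexive (sym (+-suc s len))) s+1+len≤N))
      ((s≤s z≤n , ≤-trans (≤-trans (s≤s (m≤m+n s len)) (≤-reflexive (sym (+-suc s len)))) s+1+len≤N) ∷ [])

maxWord-valid-≤ : ∀ m N → m ≤ suc N → ValidWord (suc N) (maxWord m)
maxWord-valid-≤ 0 N m≤1+N = []
maxWord-valid-≤ 1 N m≤1+N = []
maxWord-valid-≤ 2 N (s≤s 1≤N) = (s≤s z≤n , 1≤N) ∷ []
maxWord-valid-≤ (suc (suc (suc k))) N (s≤s 2+k≤N) =
  ++⁺ (maxWord-valid-≤ (suc k) N (≤-trans (n≤1+n _) (≤-trans (n≤1+n _) (s≤s 2+k≤N))))
   (++⁺ (bubbleLeft-valid 1 k N (≤-trans (n≤1+n _) 2+k≤N))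
     (++⁺ (bubbleLeft-valid 0 (2 + k) N 2+k≤N) ((s≤s z≤n , ≤-trans (s≤s (s≤s z≤n)) 2+k≤N) ∷ [])))

maxWord-valid : ∀ n → ValidWord n (maxWord n)
maxWord-valid zero = []
maxWord-valid (suc N) = maxWord-valid-≤ (suc N) N ≤-refl

-- Inversions and reduced words

countᵇ : (ℕ → Bool) → List ℕ → ℕ
countᵇ f [] = 0
countᵇ f (y ∷ ys) = (if f y then 1 else 0) + countᵇ f ys

countᵇ-swapAt : ∀ f k xs → countᵇ f (swapAt k xs) ≡ countᵇ f xs
countᵇ-swapAt f zero xs = refl
countᵇ-swapAt f 1 [] = refl
countᵇ-swapAt f 1 (a ∷ []) = refl
countᵇ-swapAt f 1 (a ∷ b ∷ xs) = x∙yz≈y∙xz (if f b then 1 else 0) (if f a then 1 else 0) (countᵇ f xs)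
countᵇ-swapAt f (suc (suc k)) [] = refl
countᵇ-swapAt f (suc (suc k)) (x ∷ xs) = cong (_ +_) (countᵇ-swapAt f (suc k) xs)

inversions : List ℕ → ℕ
inversions [] = 0
inversions (x ∷ xs) = countᵇ (_<ᵇ x) xs + inversions xs

AscentAt : ℕ → List ℕ → Set
AscentAt 1 (a ∷ b ∷ xs) = a < b
AscentAt (suc (suc k)) (x ∷ xs) = AscentAt (suc k) xs
AscentAt _ _ = ⊥

<ᵇ≡true⇒< : ∀ {x y} → (x <ᵇ y) ≡ true → x < y
<ᵇ≡true⇒< {x} {y} e = <ᵇ⇒< x y (subst T (sym e) tt)

<ᵇ≡false⇒≥ : ∀ {x y} → (x <ᵇ y) ≡ false → y ≤ x
<ᵇ≡false⇒≥ e = ≮⇒≥ (λ lt → subst T e (<⇒<ᵇ lt))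

<⇒<ᵇ≡true : ∀ {x y} → x < y → (x <ᵇ y) ≡ true
<⇒<ᵇ≡true {x} {y} lt with x <ᵇ y in e
... | true = refl
... | false = ⊥-elim (<⇒≱ lt (<ᵇ≡false⇒≥ e))

≥⇒<ᵇ≡false : ∀ {x y} → y ≤ x → (x <ᵇ y) ≡ false
≥⇒<ᵇ≡false {x} {y} le with x <ᵇ y in e
... | true = ⊥-elim (<⇒≱ (<ᵇ≡true⇒< e) le)
... | false = refl

<ᵇ-trans-contra : ∀ {a b c} → (a <ᵇ b) ≡ true → (b <ᵇ c) ≡ true → (a <ᵇ c) ≡ false → ⊥
<ᵇ-trans-contra {a} {b} {c} a<b b<c a≮c =
  <⇒≱ (<-trans (<ᵇ≡true⇒< {a} {b} a<b) (<ᵇ≡true⇒< {b} {c} b<c)) (<ᵇ≡false⇒≥ {a} {c} a≮c)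

≮ᵇ-trans-contra : ∀ {a b c} → (a <ᵇ b) ≡ false → (b <ᵇ c) ≡ false → (a <ᵇ c) ≡ true → ⊥
≮ᵇ-trans-contra {a} {b} {c} a≮b b≮c a<c =
  <⇒≱ (<ᵇ≡true⇒< {a} {c} a<c) (≤-trans (<ᵇ≡false⇒≥ {b} {c} b≮c) (<ᵇ≡false⇒≥ {a} {b} a≮b))

inversions-swapAt : ∀ k p → (AscentAt k p × inversions (swapAt k p) ≡ suc (inversions p))
                          ⊎ inversions (swapAt k p) ≤ inversions p
inversions-swapAt zero p = inj₂ ≤-refl
inversions-swapAt 1 [] = inj₂ ≤-refl
inversions-swapAt 1 (a ∷ []) = inj₂ ≤-refl
inversions-swapAt 1 (a ∷ b ∷ xs) with a <ᵇ b in a<ᵇb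
... | true rewrite ≥⇒<ᵇ≡false {b} {a} (<⇒≤ (<ᵇ≡true⇒< a<ᵇb)) =
  inj₁ (<ᵇ≡true⇒< a<ᵇb , cong suc (x∙yz≈y∙xz (countᵇ (_<ᵇ b) xs) (countᵇ (_<ᵇ a) xs) (inversions xs)))
... | false = inj₂ (begin
    countᵇ (_<ᵇ b) xs + (countᵇ (_<ᵇ a) xs + inversions xs)
  ≡⟨ x∙yz≈y∙xz (countᵇ (_<ᵇ b) xs) (countᵇ (_<ᵇ a) xs) (inversions xs) ⟩
    countᵇ (_<ᵇ a) xs + (countᵇ (_<ᵇ b) xs + inversions xs)
  ≤⟨ m≤n+m _ (if b <ᵇ a then 1 else 0) ⟩
    (if b <ᵇ a then 1 else 0) + (countᵇ (_<ᵇ a) xs + (countᵇ (_<ᵇ b) xs + inversions xs))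
  ≡⟨ sym (+-assoc (if b <ᵇ a then 1 else 0) _ _) ⟩
    inversions (a ∷ b ∷ xs)
  ∎)
  where open ≤-Reasoning
inversions-swapAt (suc (suc k)) [] = inj₂ ≤-refl
inversions-swapAt (suc (suc k)) (x ∷ xs) rewrite countᵇ-swapAt (_<ᵇ x) (suc k) xs with inversions-swapAt (suc k) xs
... | inj₁ (ascent , raises) = inj₁ (ascent , trans (cong (countᵇ (_<ᵇ x) xs +_) raises) (+-suc _ _))
... | inj₂ lowers = inj₂ (+-monoʳ-≤ (countᵇ (_<ᵇ x) xs) lowers)

inversions-applyWord-≤ : ∀ p w → inversions (applyWord p w) ≤ inversions p + length w
inversions-applyWord-≤ p [] = ≤-reflexive (sym (+-identityʳ _))
inversions-applyWord-≤ p (i ∷ w) = begin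
    inversions (applyWord (swapAt i p) w)
  ≤⟨ inversions-applyWord-≤ (swapAt i p) w ⟩
    inversions (swapAt i p) + length w
  ≤⟨ +-monoˡ-≤ (length w) inversions-swapAt-≤ ⟩
    suc (inversions p) + length w
  ≡⟨ sym (+-suc _ _) ⟩
    inversions p + length (i ∷ w)
  ∎
  where
    open ≤-Reasoning
    inversions-swapAt-≤ : inversions (swapAt i p) ≤ suc (inversions p)
    inversions-swapAt-≤ with inversions-swapAt i p
    ... | inj₁ (_ , raises) = ≤-reflexive raises
    ... | inj₂ lowers = m≤n⇒m≤1+n lowers

-- ℓ(p · w) = ℓ(p) + ℓ(w): every letter of w acts on an ascent.
LengthAdditive : List ℕ → List ℕ → Set
LengthAdditive p w = inversions p + length w ≤ inversions (applyWord p w)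

countᵇ-<ᵇ-ascending : ∀ x a n → x ≤ a → countᵇ (_<ᵇ x) (ascending a n) ≡ 0
countᵇ-<ᵇ-ascending x a zero x≤a = refl
countᵇ-<ᵇ-ascending x a (suc n) x≤a rewrite ≥⇒<ᵇ≡false {a} {x} x≤a =
  countᵇ-<ᵇ-ascending x (suc a) n (m≤n⇒m≤1+n x≤a)

inversions-ascending : ∀ a n → inversions (ascending a n) ≡ 0
inversions-ascending a zero = refl
inversions-ascending a (suc n) rewrite countᵇ-<ᵇ-ascending a (suc a) n (n≤1+n a) = inversions-ascending (suc a) n

inversions-idPerm : ∀ n → inversions (idPerm n) ≡ 0
inversions-idPerm n = trans (cong inversions (idPerm≡ascending n)) (inversions-ascending 1 n)

choose2 : ℕ → ℕ
choose2 zero = 0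
choose2 (suc n) = n + choose2 n

countᵇ-<ᵇ-applyDownFrom : ∀ m n → m ≤ n → countᵇ (_<ᵇ suc n) (applyDownFrom suc m) ≡ m
countᵇ-<ᵇ-applyDownFrom zero n m≤n = refl
countᵇ-<ᵇ-applyDownFrom (suc m) n 1+m≤n rewrite <⇒<ᵇ≡true {suc m} {suc n} (s≤s 1+m≤n) =
  cong suc (countᵇ-<ᵇ-applyDownFrom m n (≤-trans (n≤1+n m) 1+m≤n))

inversions-w₀ : ∀ n → inversions (w₀ n) ≡ choose2 n
inversions-w₀ n = trans (cong inversions (w₀≡applyDownFrom n)) (go n)
  where
    go : ∀ n → inversions (applyDownFrom suc n) ≡ choose2 n
    go zero = refl
    go (suc n) rewrite countᵇ-<ᵇ-applyDownFrom n n ≤-refl = cong (n +_) (go n)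

length-maxWord : ∀ m → length (maxWord m) ≡ choose2 m
length-maxWord 0 = refl
length-maxWord 1 = refl
length-maxWord 2 = refl
length-maxWord (suc (suc (suc k))) = begin
    length (maxWord (suc k) ++ bubbleLeft 1 k ++ bubbleLeft 0 (2 + k) ++ [ 2 ])
  ≡⟨ length-++ (maxWord (suc k)) ⟩
    length (maxWord (suc k)) + length (bubbleLeft 1 k ++ bubbleLeft 0 (2 + k) ++ [ 2 ])
  ≡⟨ cong (length (maxWord (suc k)) +_) (length-++ (bubbleLeft 1 k)) ⟩
    length (maxWord (suc k)) + (length (bubbleLeft 1 k) + length (bubbleLeft 0 (2 + k) ++ [ 2 ]))
  ≡⟨ cong (λ z → length (maxWord (suc k)) + (length (bubbleLeft 1 k) + z)) (length-++ (bubbleLeft 0 (2 + k))) ⟩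
    length (maxWord (suc k)) + (length (bubbleLeft 1 k) + (length (bubbleLeft 0 (2 + k)) + 1))
  ≡⟨ cong₂ (λ u v → u + (v + (length (bubbleLeft 0 (2 + k)) + 1))) (length-maxWord (suc k)) (length-bubbleLeft 1 k) ⟩
    choose2 (suc k) + (k + (length (bubbleLeft 0 (2 + k)) + 1))
  ≡⟨ cong (λ z → choose2 (suc k) + (k + (z + 1))) (length-bubbleLeft 0 (2 + k)) ⟩
    choose2 (suc k) + (k + (2 + k + 1))
  ≡⟨ arith k (choose2 k) ⟩
    choose2 (3 + k)
  ∎
  where
    open ≡-Reasoning
    arith : ∀ k c → (k + c) + (k + (2 + k + 1)) ≡ 2 + k + (suc k + (k + c))
    arith = solve-∀

length≡inversions⇒Reduced : ∀ n w → ValidWord n w → length w ≡ inversions (eval n w) → Reduced n w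
length≡inversions⇒Reduced n w valid ∣w∣≡inv = valid , λ v _ v≡w → begin
    length w
  ≡⟨ ∣w∣≡inv ⟩
    inversions (eval n w)
  ≡⟨ cong inversions (sym v≡w) ⟩
    inversions (eval n v)
  ≤⟨ inversions-applyWord-≤ (idPerm n) v ⟩
    inversions (idPerm n) + length v
  ≡⟨ cong (_+ length v) (inversions-idPerm n) ⟩
    length v
  ∎
  where open ≤-Reasoning

length-maxWord≡inversions-w₀ : ∀ n → length (maxWord n) ≡ inversions (w₀ n)
length-maxWord≡inversions-w₀ n = trans (length-maxWord n) (sym (inversions-w₀ n))

maxWord-reducedWordOfW₀ : ∀ n → ReducedWordOfW₀ n (maxWord n)
maxWord-reducedWordOfW₀ n =
  length≡inversions⇒Reduced n (maxWord n) (maxWord-valid n)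
    (trans (length-maxWord≡inversions-w₀ n) (cong inversions (sym (eval-maxWord n)))) ,
  eval-maxWord n

ReducedWordOfW₀⇒LengthAdditive : ∀ n w → ReducedWordOfW₀ n w → LengthAdditive (idPerm n) w
ReducedWordOfW₀⇒LengthAdditive n w ((_ , minimal) , w≡w₀) = begin
    inversions (idPerm n) + length w
  ≡⟨ cong (_+ length w) (inversions-idPerm n) ⟩
    length w
  ≤⟨ minimal (maxWord n) (maxWord-valid n) (trans (eval-maxWord n) (sym w≡w₀)) ⟩
    length (maxWord n)
  ≡⟨ length-maxWord≡inversions-w₀ n ⟩
    inversions (w₀ n)
  ≡⟨ cong inversions (sym w≡w₀) ⟩
    inversions (eval n w)
  ∎
  where open ≤-Reasoning

⌊3_/2⌋ : ℕ → ℕ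
⌊3 zero /2⌋ = 0
⌊3 suc zero /2⌋ = 1
⌊3 suc (suc m) /2⌋ = 3 + ⌊3 m /2⌋

⌈3_/2⌉ : ℕ → ℕ
⌈3 zero /2⌉ = 0
⌈3 suc zero /2⌉ = 2
⌈3 suc (suc m) /2⌉ = 3 + ⌈3 m /2⌉

⌊3/2⌋-suc : ∀ m → ⌊3 suc m /2⌋ ≡ suc ⌈3 m /2⌉
⌊3/2⌋-suc zero = refl
⌊3/2⌋-suc (suc zero) = refl
⌊3/2⌋-suc (suc (suc m)) = cong (3 +_) (⌊3/2⌋-suc m)

⌈3/2⌉-suc : ∀ m → ⌈3 suc m /2⌉ ≡ 2 + ⌊3 m /2⌋
⌈3/2⌉-suc zero = refl
⌈3/2⌉-suc (suc zero) = refl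
⌈3/2⌉-suc (suc (suc m)) = cong (3 +_) (⌈3/2⌉-suc m)

⌊3/2⌋≤⌈3/2⌉ : ∀ m → ⌊3 m /2⌋ ≤ ⌈3 m /2⌉
⌊3/2⌋≤⌈3/2⌉ zero = z≤n
⌊3/2⌋≤⌈3/2⌉ (suc zero) = s≤s z≤n
⌊3/2⌋≤⌈3/2⌉ (suc (suc m)) = +-monoʳ-≤ 3 (⌊3/2⌋≤⌈3/2⌉ m)

⌈3/2⌉≤1+⌊3/2⌋ : ∀ m → ⌈3 m /2⌉ ≤ suc ⌊3 m /2⌋
⌈3/2⌉≤1+⌊3/2⌋ zero = z≤n
⌈3/2⌉≤1+⌊3/2⌋ (suc zero) = s≤s (s≤s z≤n)
⌈3/2⌉≤1+⌊3/2⌋ (suc (suc m)) = +-monoʳ-≤ 3 (⌈3/2⌉≤1+⌊3/2⌋ m)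

monotone-by-steps : (f : ℕ → ℕ) → (∀ m → f m ≤ f (suc m)) → ∀ {x y} → x ≤ y → f x ≤ f y
monotone-by-steps f step x≤y = go (≤⇒≤′ x≤y)
  where
    go : ∀ {x y} → x ≤′ y → f x ≤ f y
    go ≤′-refl = ≤-refl
    go (≤′-step x≤′y) = ≤-trans (go x≤′y) (step _)

⌊3/2⌋-mono-≤ : ∀ {x y} → x ≤ y → ⌊3 x /2⌋ ≤ ⌊3 y /2⌋
⌊3/2⌋-mono-≤ = monotone-by-steps ⌊3_/2⌋ λ m →
  ≤-trans (m≤n⇒m≤1+n (⌊3/2⌋≤⌈3/2⌉ m)) (≤-reflexive (sym (⌊3/2⌋-suc m)))

⌈3/2⌉-mono-≤ : ∀ {x y} → x ≤ y → ⌈3 x /2⌉ ≤ ⌈3 y /2⌉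
⌈3/2⌉-mono-≤ = monotone-by-steps ⌈3_/2⌉ λ m →
  ≤-trans (m≤n⇒m≤1+n (⌈3/2⌉≤1+⌊3/2⌋ m)) (≤-reflexive (sym (⌈3/2⌉-suc m)))

⌈3[3+k]/2⌉∸3 : ∀ k → ⌈ 3 * (3 + k) /2⌉ ∸ 3 ≡ 2 + ⌊3 k /2⌋
⌈3[3+k]/2⌉∸3 k = cong (_∸ 3) (go k)
  where
    go : ∀ k → ⌈ 3 * (3 + k) /2⌉ ≡ 5 + ⌊3 k /2⌋
    go 0 = refl
    go 1 = refl
    go (suc (suc k)) = trans (cong ⌈_/2⌉ (3*[5+k]≡6+3*[3+k] k)) (cong (3 +_) (go k))
      where
        3*[5+k]≡6+3*[3+k] : ∀ k → 3 * (5 + k) ≡ 6 + 3 * (3 + k)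
        3*[5+k]≡6+3*[3+k] = solve-∀

occ-++ : ∀ k xs ys → occ k (xs ++ ys) ≡ occ k xs + occ k ys
occ-++ k xs ys = trans (cong length (filter-++ (k ≟_) xs ys)) (length-++ (filter (k ≟_) xs))

occ₂-bubbleLeft-above : ∀ s len → occ 2 (bubbleLeft (2 + s) len) ≡ 0
occ₂-bubbleLeft-above s zero = refl
occ₂-bubbleLeft-above s (suc len) =
  trans (occ-++ 2 (bubbleLeft (3 + s) len) [ 3 + s ]) (cong (_+ 0) (occ₂-bubbleLeft-above (suc s) len))

occ₂-bubbleLeft₁ : ∀ len → occ 2 (bubbleLeft 1 (suc len)) ≡ 1
occ₂-bubbleLeft₁ len = trans (occ-++ 2 (bubbleLeft 2 len) [ 2 ]) (cong (_+ 1) (occ₂-bubbleLeft-above 0 len))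

occ₂-bubbleLeft₀ : ∀ len → occ 2 (bubbleLeft 0 (2 + len)) ≡ 1
occ₂-bubbleLeft₀ len = trans (occ-++ 2 (bubbleLeft 1 (suc len)) [ 1 ]) (cong (_+ 0) (occ₂-bubbleLeft₁ len))

occ₂-maxWord-step : ∀ k → occ 2 (bubbleLeft 1 (suc k) ++ bubbleLeft 0 (3 + k) ++ [ 2 ]) ≡ 3
occ₂-maxWord-step k
  rewrite occ-++ 2 (bubbleLeft 1 (suc k)) (bubbleLeft 0 (3 + k) ++ [ 2 ])
        | occ-++ 2 (bubbleLeft 0 (3 + k)) [ 2 ]
        | occ₂-bubbleLeft₁ k
        | occ₂-bubbleLeft₀ (suc k) = refl

occ₂-maxWord : ∀ k → occ 2 (maxWord (3 + k)) ≡ 2 + ⌊3 k /2⌋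
occ₂-maxWord 0 = refl
occ₂-maxWord 1 = refl
occ₂-maxWord (suc (suc k)) = begin
    occ 2 (maxWord (3 + k) ++ bubbleLeft 1 (2 + k) ++ bubbleLeft 0 (4 + k) ++ [ 2 ])
  ≡⟨ occ-++ 2 (maxWord (3 + k)) _ ⟩
    occ 2 (maxWord (3 + k)) + occ 2 (bubbleLeft 1 (2 + k) ++ bubbleLeft 0 (4 + k) ++ [ 2 ])
  ≡⟨ cong₂ _+_ (occ₂-maxWord k) (occ₂-maxWord-step (suc k)) ⟩
    2 + ⌊3 k /2⌋ + 3
  ≡⟨ cong (2 +_) (+-comm ⌊3 k /2⌋ 3) ⟩
    2 + ⌊3 suc (suc k) /2⌋
  ∎
  where open ≡-Reasoning

-- The potential

countAbove : ℕ → List ℕ → ℕ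
countAbove x = countᵇ (x <ᵇ_)

countAbove-antitone : ∀ {x y} r → x ≤ y → countAbove y r ≤ countAbove x r
countAbove-antitone [] x≤y = z≤n
countAbove-antitone {x} {y} (z ∷ r) x≤y = +-mono-≤ head (countAbove-antitone r x≤y)
  where
    head : (if y <ᵇ z then 1 else 0) ≤ (if x <ᵇ z then 1 else 0)
    head with y <ᵇ z in y<ᵇz
    ... | false = z≤n
    ... | true rewrite <⇒<ᵇ≡true {x} {z} (≤-<-trans x≤y (<ᵇ≡true⇒< y<ᵇz)) = ≤-refl

-- The relative order of a, b, c is encoded by (a <ᵇ b, b <ᵇ c, a <ᵇ c); the two
-- inconsistent triples never occur.
median : Bool → Bool → Bool → ℕ → ℕ → ℕ → ℕ
median true  true  true  a b c = b
median true  false true  a b c = c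
median true  false false a b c = a
median false true  true  a b c = a
median false true  false a b c = c
median false false false a b c = b
median true  true  false a b c = a
median false false true  a b c = a

weight : Bool → Bool → Bool → ℕ → ℕ
weight true  true  true  m = 2 + ⌊3 m /2⌋
weight true  false true  m = 1 + ⌊3 m /2⌋
weight true  false false m = ⌈3 m /2⌉
weight false true  true  m = 1 + ⌈3 m /2⌉
weight false true  false m = 1 + ⌊3 m /2⌋
weight false false false m = ⌊3 m /2⌋
weight true  true  false m = 0
weight false false true  m = 0

Φ : List ℕ → ℕ
Φ (a ∷ b ∷ c ∷ r) = weight (a <ᵇ b) (b <ᵇ c) (a <ᵇ c) (countAbove (median (a <ᵇ b) (b <ᵇ c) (a <ᵇ c) a b c) r)
Φ _ = 0

Φ-swap₁ : ∀ a b c r → a < b → Φ (b ∷ a ∷ c ∷ r) ≤ Φ (a ∷ b ∷ c ∷ r)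
Φ-swap₁ a b c r a<b rewrite <⇒<ᵇ≡true a<b | ≥⇒<ᵇ≡false {b} {a} (<⇒≤ a<b) with b <ᵇ c in b<ᵇc | a <ᵇ c in a<ᵇc
... | true  | true  = s≤s (⌈3/2⌉≤1+⌊3/2⌋ (countAbove b r))
... | true  | false = ⊥-elim (<ᵇ-trans-contra {a} {b} {c} (<⇒<ᵇ≡true a<b) b<ᵇc a<ᵇc)
... | false | true  = ≤-refl
... | false | false = ⌊3/2⌋≤⌈3/2⌉ (countAbove a r)

Φ-swap₂ : ∀ a b c r → b < c → suc (Φ (a ∷ c ∷ b ∷ r)) ≤ Φ (a ∷ b ∷ c ∷ r)
Φ-swap₂ a b c r b<c rewrite <⇒<ᵇ≡true b<c | ≥⇒<ᵇ≡false {c} {b} (<⇒≤ b<c) with a <ᵇ b in a<ᵇb | a <ᵇ c in a<ᵇc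
... | true  | true  = ≤-refl
... | true  | false = ⊥-elim (<ᵇ-trans-contra {a} {b} {c} a<ᵇb (<⇒<ᵇ≡true b<c) a<ᵇc)
... | false | true  = ≤-refl
... | false | false = ≤-refl

-- One clause per relative order of a, b, c, d with c < d; the other outcomes of
-- the five comparisons contradict transitivity.
Φ-swap₃ : ∀ a b c d r → c < d → Φ (a ∷ b ∷ d ∷ c ∷ r) ≤ Φ (a ∷ b ∷ c ∷ d ∷ r)
Φ-swap₃ a b c d r c<d with a <ᵇ b in a<ᵇb | b <ᵇ c in b<ᵇc | a <ᵇ c in a<ᵇc | b <ᵇ d in b<ᵇd | a <ᵇ d in a<ᵇd
... | true | true | true | true | true rewrite b<ᵇc | b<ᵇd = ≤-refl
... | true | true | true | false | _ = ⊥-elim (<ᵇ-trans-contra {b} {c} {d} b<ᵇc (<⇒<ᵇ≡true {c} {d} c<d) b<ᵇd)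
... | true | true | true | true | false = ⊥-elim (<ᵇ-trans-contra {a} {c} {d} a<ᵇc (<⇒<ᵇ≡true {c} {d} c<d) a<ᵇd)
... | true | true | false | _ | _ = ⊥-elim (<ᵇ-trans-contra {a} {b} {c} a<ᵇb b<ᵇc a<ᵇc)
... | true | false | true | true | true rewrite b<ᵇc | <⇒<ᵇ≡true {c} {d} c<d | ⌊3/2⌋-suc (countAbove c r) =
  s≤s (s≤s (≤-trans (⌊3/2⌋-mono-≤ (countAbove-antitone r (<ᵇ≡false⇒≥ {b} {c} b<ᵇc))) (⌊3/2⌋≤⌈3/2⌉ (countAbove c r))))
... | true | false | true | false | true rewrite ≥⇒<ᵇ≡false {d} {c} (<⇒≤ c<d) | <⇒<ᵇ≡true {c} {d} c<d =
  s≤s (⌊3/2⌋-mono-≤ (≤-trans (countAbove-antitone r (<⇒≤ c<d)) (n≤1+n _)))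
... | true | false | true | _ | false = ⊥-elim (<ᵇ-trans-contra {a} {c} {d} a<ᵇc (<⇒<ᵇ≡true {c} {d} c<d) a<ᵇd)
... | true | false | false | true | true rewrite b<ᵇc | a<ᵇd | ⌈3/2⌉-suc (countAbove a r) =
  s≤s (s≤s (⌊3/2⌋-mono-≤ (countAbove-antitone r (<⇒≤ (<ᵇ≡true⇒< {a} {b} a<ᵇb)))))
... | true | false | false | true | false = ⊥-elim (<ᵇ-trans-contra {a} {b} {d} a<ᵇb b<ᵇd a<ᵇd)
... | true | false | false | false | true rewrite ≥⇒<ᵇ≡false {d} {c} (<⇒≤ c<d) | a<ᵇd | ⌈3/2⌉-suc (countAbove a r) =
  s≤s (≤-trans (⌊3/2⌋-mono-≤ (countAbove-antitone r (<⇒≤ (<ᵇ≡true⇒< {a} {d} a<ᵇd)))) (n≤1+n _))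
... | true | false | false | false | false rewrite a<ᵇc | a<ᵇd = ≤-refl
... | false | true | true | true | true rewrite a<ᵇc | a<ᵇd = ≤-refl
... | false | true | true | false | _ = ⊥-elim (<ᵇ-trans-contra {b} {c} {d} b<ᵇc (<⇒<ᵇ≡true {c} {d} c<d) b<ᵇd)
... | false | true | true | true | false = ⊥-elim (<ᵇ-trans-contra {a} {c} {d} a<ᵇc (<⇒<ᵇ≡true {c} {d} c<d) a<ᵇd)
... | false | true | false | true | true rewrite a<ᵇc | <⇒<ᵇ≡true {c} {d} c<d | ⌊3/2⌋-suc (countAbove c r) =
  s≤s (≤-trans (⌈3/2⌉-mono-≤ (countAbove-antitone r (<ᵇ≡false⇒≥ {a} {c} a<ᵇc))) (n≤1+n _))
... | false | true | false | true | false rewrite ≥⇒<ᵇ≡false {d} {c} (<⇒≤ c<d) | <⇒<ᵇ≡true {c} {d} c<d =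
  s≤s (⌊3/2⌋-mono-≤ (≤-trans (countAbove-antitone r (<⇒≤ c<d)) (n≤1+n _)))
... | false | true | false | false | _ = ⊥-elim (<ᵇ-trans-contra {b} {c} {d} b<ᵇc (<⇒<ᵇ≡true {c} {d} c<d) b<ᵇd)
... | false | false | true | _ | _ = ⊥-elim (≮ᵇ-trans-contra {a} {b} {c} a<ᵇb b<ᵇc a<ᵇc)
... | false | false | false | false | false rewrite b<ᵇc | b<ᵇd = ≤-refl
... | false | false | false | true | true rewrite a<ᵇc | b<ᵇd | ⌊3/2⌋-suc (countAbove b r) =
  s≤s (⌈3/2⌉-mono-≤ (countAbove-antitone r (<ᵇ≡false⇒≥ {a} {b} a<ᵇb)))
... | false | false | false | true | false rewrite ≥⇒<ᵇ≡false {d} {c} (<⇒≤ c<d) | b<ᵇd | ⌊3/2⌋-suc (countAbove b r) =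
  s≤s (≤-trans (⌊3/2⌋-mono-≤ (countAbove-antitone r (<⇒≤ (<ᵇ≡true⇒< {b} {d} b<ᵇd)))) (⌊3/2⌋≤⌈3/2⌉ (countAbove b r)))
... | false | false | false | false | true = ⊥-elim (≮ᵇ-trans-contra {a} {b} {d} a<ᵇb b<ᵇd a<ᵇd)

Φ-ascent : ∀ k p → AscentAt k p → occ 2 [ k ] + Φ (swapAt k p) ≤ Φ p
Φ-ascent 1 (a ∷ b ∷ []) a<b = z≤n
Φ-ascent 1 (a ∷ b ∷ c ∷ r) a<b = Φ-swap₁ a b c r a<b
Φ-ascent 2 (a ∷ b ∷ c ∷ r) b<c = Φ-swap₂ a b c r b<c
Φ-ascent 3 (a ∷ b ∷ c ∷ d ∷ r) c<d = Φ-swap₃ a b c d r c<d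
Φ-ascent (suc (suc (suc (suc j)))) (a ∷ b ∷ c ∷ r) _
  rewrite countᵇ-swapAt (median (a <ᵇ b) (b <ᵇ c) (a <ᵇ c) a b c <ᵇ_) (suc j) r = ≤-refl

LengthAdditive⇒occ₂+Φ≤Φ : ∀ w p → LengthAdditive p w → occ 2 w + Φ (applyWord p w) ≤ Φ p
LengthAdditive⇒occ₂+Φ≤Φ [] p _ = ≤-refl
LengthAdditive⇒occ₂+Φ≤Φ (i ∷ w) p additive with inversions-swapAt i p
... | inj₁ (ascent , raises) = begin
    occ 2 ([ i ] ++ w) + Φ (applyWord (swapAt i p) w)
  ≡⟨ cong (_+ Φ (applyWord (swapAt i p) w)) (occ-++ 2 [ i ] w) ⟩
    occ 2 [ i ] + occ 2 w + Φ (applyWord (swapAt i p) w)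
  ≡⟨ +-assoc (occ 2 [ i ]) _ _ ⟩
    occ 2 [ i ] + (occ 2 w + Φ (applyWord (swapAt i p) w))
  ≤⟨ +-monoʳ-≤ (occ 2 [ i ]) (LengthAdditive⇒occ₂+Φ≤Φ w (swapAt i p) additive′) ⟩
    occ 2 [ i ] + Φ (swapAt i p)
  ≤⟨ Φ-ascent i p ascent ⟩
    Φ p
  ∎
  where
    open ≤-Reasoning
    additive′ : LengthAdditive (swapAt i p) w
    additive′ rewrite raises = ≤-trans (≤-reflexive (sym (+-suc (inversions p) (length w)))) additive
... | inj₂ lowers = ⊥-elim (<⇒≱ too-few additive)
  where
    too-few : inversions (applyWord (swapAt i p) w) < inversions p + suc (length w)
    too-few = ≤-<-trans (inversions-applyWord-≤ (swapAt i p) w)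
                (≤-<-trans (+-monoˡ-≤ (length w) lowers) (≤-reflexive (sym (+-suc (inversions p) (length w)))))

countAbove-ascending : ∀ x a n → x < a → countAbove x (ascending a n) ≡ n
countAbove-ascending x a zero x<a = refl
countAbove-ascending x a (suc n) x<a rewrite <⇒<ᵇ≡true {x} {a} x<a =
  cong suc (countAbove-ascending x (suc a) n (m≤n⇒m≤1+n x<a))

Φ-idPerm : ∀ k → Φ (idPerm (3 + k)) ≡ 2 + ⌊3 k /2⌋
Φ-idPerm k = trans (cong Φ (idPerm≡ascending (3 + k)))
                   (cong (λ m → 2 + ⌊3 m /2⌋) (countAbove-ascending 2 4 k (s≤s (s≤s (s≤s z≤n)))))

theorem3p4 : (n : ℕ) → 3 ≤ n → IsM 2 n (⌈ 3 * n /2⌉ ∸ 3)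
theorem3p4 (suc (suc (suc k))) (s≤s (s≤s (s≤s z≤n))) rewrite ⌈3[3+k]/2⌉∸3 k =
  (maxWord (3 + k) , maxWord-reducedWordOfW₀ (3 + k) , occ₂-maxWord k) ,
  λ w reduced → begin
    occ 2 w
  ≤⟨ m≤m+n (occ 2 w) _ ⟩
    occ 2 w + Φ (eval (3 + k) w)
  ≤⟨ LengthAdditive⇒occ₂+Φ≤Φ w (idPerm (3 + k)) (ReducedWordOfW₀⇒LengthAdditive (3 + k) w reduced) ⟩
    Φ (idPerm (3 + k))
  ≡⟨ Φ-idPerm k ⟩
    2 + ⌊3 k /2⌋
  ∎
  where open ≤-Reasoning
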